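{- For every first-order model $M$: for all Transition Dependence Logic formulas $\phi$ and all teams $X,Y$ over $M$, (Downwards closure) if $M\models_X\phi$ and $Y\subseteq X$ then $M\models_Y\phi$, and (Empty team property) $M\models_\emptyset\phi$. Furthermore, for all Transition Dependence Logic transition terms $\tau$ and all teams $X,Y,Z$ over $M$: (Downwards closure) if $M\models_{X\rightarrow Y}\tau$ and $Z\subseteq X$ then $M\models_{Z\rightarrow Y}\tau$; (Monotonicity) if $M\models_{X\rightarrow Y}\tau$ and $Y\subseteq Z$ then $M\models_{X\rightarrow Z}\tau$; (Non-creation) $M\models_{\emptyset\rightarrow Y}\tau$ for all $Y$; (Non-triviality) if $X\neq\emptyset$ then $M\not\models_{X\rightarrow\emptyset}\tau$.
   Context: Teams over $M$ are sets of assignments $s:\mathrm{Var}\to\mathrm{dom}(M)$, where $\mathrm{Var}$ is the set of all variables; $s[m/v]$ changes the value of $v$ to $m$; $X[F/v]=\{s[F(s)/v]:s\in X\}$ for $F:X\to\mathrm{dom}(M)$, and $X[M/v]=\{s[m/v]:s\in X,m\in\mathrm{dom}(M)\}$. Transition Dependence Logic (TDL) over a signature $\Sigma$ has transition terms $\tau ::= \exists v\mid\forall v\mid\phi?\mid\tau\otimes\tau\mid\tau\cap\tau\mid\tau;\tau$ and formulas $\phi ::= R\vec t\mid\lnot R\vec t\mid=\!(t_1,\ldots,t_n)\mid\phi\vee\phi\mid\phi\wedge\phi\mid\langle\tau\rangle\phi$. Semantics: $M\models_{X\rightarrow Y}\exists v$ iff $X[F/v]\subseteq Y$ for some $F:X\to\mathrm{dom}(M)$;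 $M\models_{X\rightarrow Y}\forall v$ iff $X[M/v]\subseteq Y$; $M\models_{X\rightarrow Y}\phi?$ iff $M\models_X\phi$ and $X\subseteq Y$; $M\models_{X\rightarrow Y}\tau_1\otimes\tau_2$ iff $X=X_1\cup X_2$ with $M\models_{X_1\rightarrow Y}\tau_1$ and $M\models_{X_2\rightarrow Y}\tau_2$; $M\models_{X\rightarrow Y}\tau_1\cap\tau_2$ iff both $M\models_{X\rightarrow Y}\tau_1$ and $M\models_{X\rightarrow Y}\tau_2$; $M\models_{X\rightarrow Y}\tau_1;\tau_2$ iff some team $Z$ has $M\models_{X\rightarrow Z}\tau_1$ and $M\models_{Z\rightarrow Y}\tau_2$. For formulas: a first-order literal holds in $X$ iff it holds (first-order) in every $s\in X$; $=\!(t_1,\ldots,t_n)$ holds iff any $s,s'\in X$ assigning the same values to $t_1,\ldots,t_{n-1}$ assign the same value to $t_n$; $M\models_X\phi_1\vee\phi_2$ iff $M\models_X\phi_1$ or $M\models_X\phi_2$; $\wedge$ requires both; $M\models_X\langle\tau\rangle\psi$ iff some $Y$ has $M\models_{X\rightarrow Y}\tau$ and $M\models_Y\psi$. -}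

module Defs where

open import Level using (Level; 0ℓ; Lift) renaming (suc to lsuc)
open import Data.Nat using (ℕ; _≟_)
open import Data.List using (List; []; _∷_)
open import Data.Vec using (Vec; []; _∷_)
import Data.Sum
open import Data.Product using (Σ; _×_; _,_)
open import Relation.Nullary using (¬_; yes; no)
open import Relation.Binary.PropositionalEquality using (_≡_)
open import Relation.Unary using (Pred; _⊆_; _∪_)

record Signature : Set₁ where
  field
    Fun    : Set
    funAr  : Fun → ℕ
    Rel    : Set
    relAr  : Rel → ℕ
open Signature public

Var : Set
Var = ℕ

data Term (S : Signature) : Set where
  var : Var → Term S
  app : (f : Fun S) → Vec (Term S) (funAr S f) → Term S

record Structure (S : Signature) : Set₁ where
  field
    Dom   : Set
    elem  : Dom                                   -- domain is nonempty
    funI  : (f : Fun S) → Vec Dom (funAr S f) → Dom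
    relI  : (R : Rel S) → Vec Dom (relAr S R) → Set
open Structure public

module _ {S : Signature} (M : Structure S) where

  Assignment : Set
  Assignment = Var → Dom M

  Team : Set₁
  Team = Pred Assignment 0ℓ

  update : Assignment → Var → Dom M → Assignment
  update s v m w with w ≟ v
  ... | yes _ = m
  ... | no  _ = s w

  mutual
    eval : Assignment → Term S → Dom M
    eval s (var v)    = s v
    eval s (app f ts) = funI M f (evalVec s ts)

    evalVec : ∀ {n} → Assignment → Vec (Term S) n → Vec (Dom M) n
    evalVec s []       = []
    evalVec s (t ∷ ts) = eval s t ∷ evalVec s ts

  evalList : Assignment → List (Term S) → List (Dom M)
  evalList s []       = []
  evalList s (t ∷ ts) = eval s t ∷ evalList s ts

mutual
  data Formula (S : Signature) : Set where
    rel  : (R : Rel S) → Vec (Term S) (relAr S R) → Formula S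
    nrel : (R : Rel S) → Vec (Term S) (relAr S R) → Formula S
    -- dep ts t  is  =(t₁,…,t_{n-1}, t)  with ts = t₁,…,t_{n-1} and t = tₙ
    dep  : List (Term S) → Term S → Formula S
    _∨ᶠ_ : Formula S → Formula S → Formula S
    _∧ᶠ_ : Formula S → Formula S → Formula S
    ⟨_⟩_ : Trans S → Formula S → Formula S

  data Trans (S : Signature) : Set where
    ∃ᵗ   : Var → Trans S
    ∀ᵗ   : Var → Trans S
    _¿   : Formula S → Trans S
    _⊗_  : Trans S → Trans S → Trans S
    _∩ᵗ_ : Trans S → Trans S → Trans S
    _⨾_  : Trans S → Trans S → Trans S

module _ {S : Signature} (M : Structure S) where

  mutual
    Sat : Team M → Formula S → Set₁
    Sat X (rel R ts)  = Lift (lsuc 0ℓ) (∀ s → X s → relI M R (evalVec M s ts))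
    Sat X (nrel R ts) = Lift (lsuc 0ℓ) (∀ s → X s → ¬ relI M R (evalVec M s ts))
    Sat X (dep ts t)  = Lift (lsuc 0ℓ) (∀ s s' → X s → X s' →
                                  evalList M s ts ≡ evalList M s' ts →
                                  eval M s t ≡ eval M s' t)
    Sat X (φ ∨ᶠ ψ)    = Sat X φ Data.Sum.⊎ Sat X ψ
    Sat X (φ ∧ᶠ ψ)    = Sat X φ × Sat X ψ
    Sat X (⟨ τ ⟩ φ)   = Σ (Team M) λ Y → TSat X Y τ × Sat Y φ

    TSat : Team M → Team M → Trans S → Set₁
    TSat X Y (∃ᵗ v)     = Lift (lsuc 0ℓ) (Σ ((s : Assignment M) → X s → Dom M) λ F →
                                   ∀ s (p : X s) → Y (update M s v (F s p)))
    TSat X Y (∀ᵗ v)     = Lift (lsuc 0ℓ) (∀ s → X s → ∀ m → Y (update M s v m))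
    TSat X Y (φ ¿)      = Sat X φ × Lift (lsuc 0ℓ) (X ⊆ Y)
    TSat X Y (τ₁ ⊗ τ₂)  = Σ (Team M) λ X₁ → Σ (Team M) λ X₂ →
                           -- X = X₁ ∪ X₂ (extensional set equality)
                           Lift (lsuc 0ℓ) (X ⊆ (X₁ ∪ X₂)) × Lift (lsuc 0ℓ) (X₁ ⊆ X) × Lift (lsuc 0ℓ) (X₂ ⊆ X) ×
                           TSat X₁ Y τ₁ × TSat X₂ Y τ₂
    TSat X Y (τ₁ ∩ᵗ τ₂) = TSat X Y τ₁ × TSat X Y τ₂
    TSat X Y (τ₁ ⨾ τ₂)  = Σ (Team M) λ Z → TSat X Z τ₁ × TSat Z Y τ₂

-- The
-- one non-routine case is non-triviality of τ₁ ⨾ τ₂ from X to ∅ through Z: the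
-- hypothesis for τ₂ makes Z empty, so by monotonicity τ₁ already goes from X to
-- ∅, and the hypothesis for τ₁ makes X empty. For ∀ v it is the nonemptiness of
-- the domain that rules out the empty target.
module Submission where

open import Defs
open import Data.Product using (_×_; _,_; proj₁; proj₂)
open import Data.Sum using (inj₁; inj₂)
open import Level using (lift)
open import Relation.Nullary using (¬_)
open import Relation.Unary using (_⊆_; _∩_; _∪_; ∅; Empty)

module _ {S : Signature} (M : Structure S) where

  mutual
    sat-∅ : (φ : Formula S) → Sat M ∅ φ
    sat-∅ (rel R ts)  = lift λ _ ()
    sat-∅ (nrel R ts) = lift λ _ ()
    sat-∅ (dep ts t)  = lift λ _ _ ()
    sat-∅ (φ ∨ᶠ ψ)    = inj₁ (sat-∅ φ)
    sat-∅ (φ ∧ᶠ ψ)    = sat-∅ φ , sat-∅ ψ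
    sat-∅ (⟨ τ ⟩ φ)   = ∅ , tsat-∅ τ , sat-∅ φ

    tsat-∅ : ∀ (τ : Trans S) {Y} → TSat M ∅ Y τ
    tsat-∅ (∃ᵗ v)      = lift ((λ _ ()) , (λ _ ()))
    tsat-∅ (∀ᵗ v)      = lift λ _ ()
    tsat-∅ (φ ¿)       = sat-∅ φ , lift λ ()
    tsat-∅ (τ₁ ⊗ τ₂)   = ∅ , ∅ , lift (λ ()) , lift (λ ()) , lift (λ ()) , tsat-∅ τ₁ , tsat-∅ τ₂
    tsat-∅ (τ₁ ∩ᵗ τ₂)  = tsat-∅ τ₁ , tsat-∅ τ₂
    tsat-∅ (τ₁ ⨾ τ₂)   = ∅ , tsat-∅ τ₁ , tsat-∅ τ₂

  mutual
    sat-⊆ : ∀ (φ : Formula S) {X Y} → Sat M X φ → Y ⊆ X → Sat M Y φ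
    sat-⊆ (rel R ts)  (lift h) Y⊆X = lift λ s y → h s (Y⊆X y)
    sat-⊆ (nrel R ts) (lift h) Y⊆X = lift λ s y → h s (Y⊆X y)
    sat-⊆ (dep ts t)  (lift h) Y⊆X = lift λ s s′ y y′ → h s s′ (Y⊆X y) (Y⊆X y′)
    sat-⊆ (φ ∨ᶠ ψ)    (inj₁ a) Y⊆X = inj₁ (sat-⊆ φ a Y⊆X)
    sat-⊆ (φ ∨ᶠ ψ)    (inj₂ b) Y⊆X = inj₂ (sat-⊆ ψ b Y⊆X)
    sat-⊆ (φ ∧ᶠ ψ)    (a , b)  Y⊆X = sat-⊆ φ a Y⊆X , sat-⊆ ψ b Y⊆X
    sat-⊆ (⟨ τ ⟩ φ)   (W , t , a) Y⊆X = W , tsat-⊆ˡ τ t Y⊆X , a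

    tsat-⊆ˡ : ∀ (τ : Trans S) {X Y Z} → TSat M X Y τ → Z ⊆ X → TSat M Z Y τ
    tsat-⊆ˡ (∃ᵗ v) (lift (F , h)) Z⊆X = lift ((λ s z → F s (Z⊆X z)) , (λ s z → h s (Z⊆X z)))
    tsat-⊆ˡ (∀ᵗ v) (lift h)       Z⊆X = lift λ s z → h s (Z⊆X z)
    tsat-⊆ˡ (φ ¿)  (a , lift X⊆Y) Z⊆X = sat-⊆ φ a Z⊆X , lift λ z → X⊆Y (Z⊆X z)
    tsat-⊆ˡ (τ₁ ⊗ τ₂) {Z = Z} (X₁ , X₂ , lift X⊆X₁∪X₂ , _ , _ , t₁ , t₂) Z⊆X =
      X₁ ∩ Z , X₂ ∩ Z , lift cover , lift proj₂ , lift proj₂ ,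
      tsat-⊆ˡ τ₁ t₁ proj₁ , tsat-⊆ˡ τ₂ t₂ proj₁
      where
        cover : Z ⊆ (X₁ ∩ Z) ∪ (X₂ ∩ Z)
        cover z with X⊆X₁∪X₂ (Z⊆X z)
        ... | inj₁ x₁ = inj₁ (x₁ , z)
        ... | inj₂ x₂ = inj₂ (x₂ , z)
    tsat-⊆ˡ (τ₁ ∩ᵗ τ₂) (a , b)     Z⊆X = tsat-⊆ˡ τ₁ a Z⊆X , tsat-⊆ˡ τ₂ b Z⊆X
    tsat-⊆ˡ (τ₁ ⨾ τ₂)  (W , a , b) Z⊆X = W , tsat-⊆ˡ τ₁ a Z⊆X , b

  tsat-⊆ʳ : ∀ (τ : Trans S) {X Y Z} → TSat M X Y τ → Y ⊆ Z → TSat M X Z τ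
  tsat-⊆ʳ (∃ᵗ v) (lift (F , h)) Y⊆Z = lift (F , λ s x → Y⊆Z (h s x))
  tsat-⊆ʳ (∀ᵗ v) (lift h)       Y⊆Z = lift λ s x m → Y⊆Z (h s x m)
  tsat-⊆ʳ (φ ¿)  (a , lift X⊆Y) Y⊆Z = a , lift λ x → Y⊆Z (X⊆Y x)
  tsat-⊆ʳ (τ₁ ⊗ τ₂) (X₁ , X₂ , cov , X₁⊆X , X₂⊆X , t₁ , t₂) Y⊆Z =
    X₁ , X₂ , cov , X₁⊆X , X₂⊆X , tsat-⊆ʳ τ₁ t₁ Y⊆Z , tsat-⊆ʳ τ₂ t₂ Y⊆Z
  tsat-⊆ʳ (τ₁ ∩ᵗ τ₂) (a , b)     Y⊆Z = tsat-⊆ʳ τ₁ a Y⊆Z , tsat-⊆ʳ τ₂ b Y⊆Z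
  tsat-⊆ʳ (τ₁ ⨾ τ₂)  (W , a , b) Y⊆Z = W , a , tsat-⊆ʳ τ₂ b Y⊆Z

  tsat-into-∅⇒Empty : ∀ (τ : Trans S) {X} → TSat M X ∅ τ → Empty X
  tsat-into-∅⇒Empty (∃ᵗ v) (lift (F , h)) s x = h s x
  tsat-into-∅⇒Empty (∀ᵗ v) (lift h)       s x = h s x (elem M)
  tsat-into-∅⇒Empty (φ ¿)  (a , lift X⊆∅) s x = X⊆∅ x
  tsat-into-∅⇒Empty (τ₁ ⊗ τ₂) (X₁ , X₂ , lift X⊆X₁∪X₂ , _ , _ , t₁ , t₂) s x
    with X⊆X₁∪X₂ x
  ... | inj₁ x₁ = tsat-into-∅⇒Empty τ₁ t₁ s x₁
  ... | inj₂ x₂ = tsat-into-∅⇒Empty τ₂ t₂ s x₂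
  tsat-into-∅⇒Empty (τ₁ ∩ᵗ τ₂) (a , _) = tsat-into-∅⇒Empty τ₁ a
  tsat-into-∅⇒Empty (τ₁ ⨾ τ₂) (W , a , b) =
    tsat-into-∅⇒Empty τ₁ (tsat-⊆ʳ τ₁ a λ {s} → tsat-into-∅⇒Empty τ₂ b s)

mainTheorem6 : ∀ {S : Signature} (M : Structure S) →
    (∀ (φ : Formula S) (X Y : Team M) →
        (Sat M X φ → Y ⊆ X → Sat M Y φ) × Sat M ∅ φ) ×
    (∀ (τ : Trans S) (X Y Z : Team M) →
        (TSat M X Y τ → Z ⊆ X → TSat M Z Y τ) ×
        (TSat M X Y τ → Y ⊆ Z → TSat M X Z τ) ×
        TSat M ∅ Y τ ×
        (¬ Empty X → ¬ TSat M X ∅ τ))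
mainTheorem6 M =
  (λ φ X Y → sat-⊆ M φ , sat-∅ M φ) ,
  (λ τ X Y Z → tsat-⊆ˡ M τ , tsat-⊆ʳ M τ , tsat-∅ M τ ,
     λ X≢∅ t → X≢∅ (tsat-into-∅⇒Empty M τ t))
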